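{- Let $f: A^*\to B^*$ be a non-erasing morphism that is strongly quasiperiodic on infinite words. Then for every infinite word $\mathbf{w}$ over $A$ and every letter $\alpha\in A$, the quasiperiod of $f(\mathbf{w})$ is a factor of $f(\alpha)^3$ of length less than $2|f(\alpha)|$; in particular it belongs to $\mathcal{Q}(f)$.
   Context: For a non-empty word $q$, an infinite word $\mathbf{x}$ is $q$-quasiperiodic if every position of $\mathbf{x}$ lies within some occurrence of $q$ in $\mathbf{x}$; it is quasiperiodic if it is $q$-quasiperiodic for some $q$, and its quasiperiod is the shortest such $q$. The morphism $f$ is strongly quasiperiodic on infinite words if $f(\mathbf{w})$ is quasiperiodic for every infinite word $\mathbf{w}$ over $A$. $\mathcal{Q}(f)$ denotes the set of non-empty words $q$ such that for every letter $\alpha\in A$, $|q|\le 2|f(\alpha)|$ and $q$ is a factor of $f(\alpha)^3$. -}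

module Defs where

open import Data.Nat using (ℕ; zero; suc; _+_; _*_; _≤_; _<_)
open import Data.List using (List; []; _∷_; _++_; length)
open import Data.Product using (Σ; _×_; ∃; ∃-syntax)
open import Data.Unit using (⊤)
open import Relation.Binary.PropositionalEquality using (_≡_)

InfWord : Set → Set
InfWord X = ℕ → X

OccursAt : {X : Set} → InfWord X → ℕ → List X → Set
OccursAt x i []      = ⊤
OccursAt x i (c ∷ q) = (x i ≡ c) × OccursAt x (suc i) q

IsQuasiperiodicWith : {X : Set} → InfWord X → List X → Set
IsQuasiperiodicWith x q =
  (1 ≤ length q) ×
  (∀ p → ∃[ i ] (i ≤ p × p < i + length q × OccursAt x i q))

Quasiperiodic : {X : Set} → InfWord X → Set
Quasiperiodic x = ∃[ q ] IsQuasiperiodicWith x q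

IsQuasiperiodOf : {X : Set} → InfWord X → List X → Set
IsQuasiperiodOf x q =
  IsQuasiperiodicWith x q × (∀ q′ → IsQuasiperiodicWith x q′ → length q ≤ length q′)

Morphism : Set → Set → Set
Morphism A B = A → List B

NonErasing : {A B : Set} → Morphism A B → Set
NonErasing f = ∀ a → 1 ≤ length (f a)

blockStart : {A B : Set} → Morphism A B → InfWord A → ℕ → ℕ
blockStart f w zero    = 0
blockStart f w (suc k) = blockStart f w k + length (f (w k))

-- x = f(w): x is the concatenation f(w 0) f(w 1) f(w 2) ...
-- (for non-erasing f this determines x uniquely)
IsImage : {A B : Set} → Morphism A B → InfWord A → InfWord B → Set
IsImage f w x = ∀ k → OccursAt x (blockStart f w k) (f (w k))

StronglyQuasiperiodic : {A B : Set} → Morphism A B → Set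
StronglyQuasiperiodic f = ∀ w x → IsImage f w x → Quasiperiodic x

Factor : {X : Set} → List X → List X → Set
Factor u v = ∃[ s ] ∃[ t ] (s ++ u ++ t ≡ v)

cube : {X : Set} → List X → List X
cube u = u ++ u ++ u

InQ : {A B : Set} → Morphism A B → List B → Set
InQ f q = (1 ≤ length q) × (∀ a → length q ≤ 2 * length (f a) × Factor q (cube (f a)))

-- Fix a letter α, put u = f(α) and L = |u|, and splice: x_k = f(w₀ ⋯ w_{k-1} α α ⋯) is x up to the
-- start of block k and uᵚ afterwards. By strong quasiperiodicity x_k has a quasiperiod, and as long as
-- it has length ≥ 2L one of its occurrences lies in the L-periodic tail, so it has period L and
-- dropping its first L letters leaves a quasiperiod; hence x_k has a quasiperiod v with |v| < 2L.
-- If |q| ≤ |v|, then q is a prefix of x, hence of x_k and of v, so it occurs wherever v does, in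
-- particular inside the tail uᵚ; so it is a factor of u³.
-- Otherwise v is a prefix of x covering x far beyond any given bound; as only the finitely many
-- prefixes shorter than q are candidates, one of them would cover all of x, against the minimality of q.
-- This compactness step is made constructive by working under a double negation, which is harmless
-- because "q occurs in uᵚ and |q| < 2L" is decidable.

module Submission where

open import Data.Fin as Fin using (Fin; fromℕ<)
open import Data.Fin.Properties using (fromℕ<-cong)
open import Data.List using (List; []; _∷_; _++_; length; drop; lookup)
open import Data.List.Properties using (length-drop; length-++)
open import Data.Nat using (ℕ; zero; suc; _+_; _*_; _∸_; _≤_; _<_; z≤n; s≤s; s≤s⁻¹; z<s; _<?_; NonZero; >-nonZero)
open import Data.Nat.DivMod using (_%_; _mod_; m%n<n; [m+n]%n≡m%n; m<n⇒m%n≡m; %-distribˡ-+; m%n%n≡m%n)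
open import Data.Nat.Induction using (<-wellFounded)
open import Data.Nat.Properties
open import Data.Product using (_×_; _,_; proj₁; proj₂; ∃-syntax)
open import Data.Sum as Sum using (_⊎_; inj₁; inj₂)
open import Data.Unit using (tt)
open import Function using (_∘_; case_of_)
open import Induction.WellFounded using (Acc; acc)
open import Relation.Binary.Definitions using (DecidableEquality)
open import Relation.Binary.PropositionalEquality
open import Relation.Nullary using (¬_; Dec; yes; no; contradiction)
open import Relation.Nullary.Decidable using (_×-dec_; map′; decidable-stable)
open import Relation.Nullary.Negation using (¬¬-map)

open import Defs

module _ {X : Set} where

  Prefix : List X → List X → Set
  Prefix u v = ∃[ t ] (u ++ t ≡ v)

  Covers : InfWord X → List X → ℕ → Set
  Covers y v p = ∃[ i ] (i ≤ p × p < i + length v × OccursAt y i v)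

  window : InfWord X → ℕ → ℕ → List X
  window y i zero    = []
  window y i (suc l) = y i ∷ window y (suc i) l

  length-window : ∀ (y : InfWord X) i l → length (window y i l) ≡ l
  length-window y i zero    = refl
  length-window y i (suc l) = cong suc (length-window y (suc i) l)

  occurs-transport : ∀ {y z : InfWord X} {i j} (v : List X) →
                     (∀ t → t < length v → y (t + i) ≡ z (t + j)) → OccursAt y i v → OccursAt z j v
  occurs-transport []      _     _         = tt
  occurs-transport {y} {z} {i} {j} (c ∷ v) agree (yc , oy) =
    trans (sym (agree 0 z<s)) yc ,
    occurs-transport v
      (λ t t< → subst₂ (λ a b → y a ≡ z b) (sym (+-suc t i)) (sym (+-suc t j)) (agree (suc t) (s≤s t<))) oy

  occurs-++ : ∀ {y : InfWord X} {i} (u v : List X) →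
              OccursAt y i u → OccursAt y (length u + i) v → OccursAt y i (u ++ v)
  occurs-++ []      v _         ov = ov
  occurs-++ {y} {i} (c ∷ u) v (yc , ou) ov =
    yc , occurs-++ u v ou (subst (λ p → OccursAt y p v) (sym (+-suc (length u) i)) ov)

  occurs-++⁻ˡ : ∀ {y : InfWord X} {i} (u v : List X) → OccursAt y i (u ++ v) → OccursAt y i u
  occurs-++⁻ˡ []      v _         = tt
  occurs-++⁻ˡ (c ∷ u) v (yc , o) = yc , occurs-++⁻ˡ u v o

  occurs-drop : ∀ {y : InfWord X} {i} k (v : List X) → OccursAt y i v → OccursAt y (k + i) (drop k v)
  occurs-drop zero    v       o       = o
  occurs-drop (suc k) []      _       = tt
  occurs-drop {y} {i} (suc k) (c ∷ v) (_ , o) =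
    subst (λ p → OccursAt y p (drop k v)) (+-suc k i) (occurs-drop k v o)

  occurs-prefix : ∀ {y : InfWord X} {i} (u v : List X) →
                  OccursAt y i u → OccursAt y i v → length u ≤ length v → Prefix u v
  occurs-prefix []      v       _         _         _         = v , refl
  occurs-prefix (c ∷ u) (d ∷ v) (yc , ou) (yd , ov) (s≤s u≤v) with occurs-prefix u v ou ov u≤v
  ... | t , eq = t , cong₂ _∷_ (trans (sym yc) yd) eq

  occurs-factor : ∀ {y : InfWord X} {i} (u v : List X) j →
                  OccursAt y i v → OccursAt y (i + j) u → j + length u ≤ length v → Factor u v
  occurs-factor {y} {i} u v zero ov ou u≤v
    with occurs-prefix u v (subst (λ p → OccursAt y p u) (+-identityʳ i) ou) ov u≤v
  ... | t , eq = [] , t , eq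
  occurs-factor {y} {i} u (c ∷ v) (suc j) (_ , ov) ou (s≤s le)
    with occurs-factor u v j ov (subst (λ p → OccursAt y p u) (+-suc i j) ou) le
  ... | s , t , eq = c ∷ s , t , cong (c ∷_) eq

  occurs⇒window : ∀ {y : InfWord X} {i} (v : List X) → OccursAt y i v → v ≡ window y i (length v)
  occurs⇒window []      _        = refl
  occurs⇒window (c ∷ v) (yc , o) = cong₂ _∷_ (sym yc) (occurs⇒window v o)

  occurs-agreeBelow : ∀ {y z : InfWord X} {b i} (v : List X) → (∀ r → r < b → y r ≡ z r) →
                      i + length v ≤ b → OccursAt y i v → OccursAt z i v
  occurs-agreeBelow {i = i} v agree v≤b =
    occurs-transport v (λ t t< →
      agree (t + i) (<-≤-trans (subst (_< i + length v) (+-comm i t) (+-monoʳ-< i t<)) v≤b))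

  occurs? : DecidableEquality X → ∀ (y : InfWord X) i v → Dec (OccursAt y i v)
  occurs? _≟_ y i []      = yes tt
  occurs? _≟_ y i (c ∷ v) = (y i ≟ c) ×-dec occurs? _≟_ y (suc i) v

  covers? : DecidableEquality X → ∀ (y : InfWord X) v p → Dec (Covers y v p)
  covers? _≟_ y v p =
    map′ (λ (i , i<1+p , cov) → i , s≤s⁻¹ i<1+p , cov) (λ (i , i≤p , cov) → i , s≤s i≤p , cov)
         (anyUpTo? (λ i → (p <? i + length v) ×-dec occurs? _≟_ y i v) (suc p))

  quasiperiod-at-0 : ∀ {y : InfWord X} {v} → IsQuasiperiodicWith y v → OccursAt y 0 v
  quasiperiod-at-0 (_ , cov) with cov 0
  ... | .0 , z≤n , _ , o = o

  covers-all⇒quasiperiodic : ∀ {y : InfWord X} {v} → (∀ p → Covers y v p) → IsQuasiperiodicWith y v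
  covers-all⇒quasiperiodic cov with cov 0
  ... | .0 , z≤n , 0<v , _ = 0<v , cov

  shorter-than-quasiperiod-¬covers : ∀ {y : InfWord X} {q v} → IsQuasiperiodOf y q → length v < length q →
                                     ¬ (∀ p → Covers y v p)
  shorter-than-quasiperiod-¬covers (_ , minimal) v<q cov = <⇒≱ v<q (minimal _ (covers-all⇒quasiperiodic cov))

  -- Covering [i, i + ℓ) needs [i, i + ℓ - k) ∪ [i + k, i + ℓ), which is where 2k ≤ ℓ comes in.
  quasiperiodic-drop-period : ∀ {y : InfWord X} {v} k → Prefix (drop k v) v → 2 * k ≤ length v →
                              IsQuasiperiodicWith y v → IsQuasiperiodicWith y (drop k v)
  quasiperiodic-drop-period {y} {v} k (t , drop++t≡v) 2k≤ℓ (_ , cov) = covers-all⇒quasiperiodic cover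
    where
    ℓ = length v
    k≤ℓ∸k : k ≤ ℓ ∸ k
    k≤ℓ∸k = subst (_≤ ℓ ∸ k) (trans (m+n∸m≡n k (k + 0)) (+-identityʳ k)) (∸-monoˡ-≤ k 2k≤ℓ)
    k+i+[ℓ∸k]≡i+ℓ : ∀ i → k + i + (ℓ ∸ k) ≡ i + ℓ
    k+i+[ℓ∸k]≡i+ℓ i =
      trans (cong (_+ (ℓ ∸ k)) (+-comm k i))
            (trans (+-assoc i k (ℓ ∸ k)) (cong (i +_) (m+[n∸m]≡n (≤-trans k≤ℓ∸k (m∸n≤m ℓ k)))))
    cover : ∀ p → Covers y (drop k v) p
    cover p with cov p
    ... | i , i≤p , p<i+ℓ , o rewrite length-drop k v with p <? i + (ℓ ∸ k)
    ...   | yes p<  = i , i≤p , p< , occurs-++⁻ˡ (drop k v) t (subst (OccursAt y i) (sym drop++t≡v) o)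
    ...   | no  p≮  =
      k + i , ≤-trans (subst (_≤ i + (ℓ ∸ k)) (+-comm i k) (+-monoʳ-≤ i k≤ℓ∸k)) (≮⇒≥ p≮) ,
      subst (p <_) (sym (k+i+[ℓ∸k]≡i+ℓ i)) p<i+ℓ , occurs-drop k v o

  PeriodicFrom : ℕ → ℕ → InfWord X → Set
  PeriodicFrom b L y = ∀ r → b ≤ r → y (r + L) ≡ y r

  periodic-agree : ∀ {b L i} {y : InfWord X} → PeriodicFrom b L y → b ≤ i →
                   ∀ t → y (t + (L + i)) ≡ y (t + i)
  periodic-agree {b} {L} {i} {y} per b≤i t =
    trans (cong y (trans (cong (t +_) (+-comm L i)) (sym (+-assoc t i L))))
          (per (t + i) (≤-trans b≤i (m≤n+m i t)))

  periodic-occurs-shift : ∀ {b L i} {y : InfWord X} (v : List X) → PeriodicFrom b L y → b ≤ i →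
                          OccursAt y i v → OccursAt y (L + i) v
  periodic-occurs-shift v per b≤i = occurs-transport v (λ t _ → sym (periodic-agree per b≤i t))

  periodic-occurrence⇒period : ∀ {b L i} {y : InfWord X} (v : List X) → PeriodicFrom b L y → b ≤ i →
                               OccursAt y i v → Prefix (drop L v) v
  periodic-occurrence⇒period {L = L} v per b≤i o =
    occurs-prefix (drop L v) v
      (occurs-transport (drop L v) (λ t _ → periodic-agree per b≤i t) (occurs-drop L v o)) o
      (subst (_≤ length v) (sym (length-drop L v)) (m∸n≤m (length v) L))

  short-quasiperiod : ∀ {b L} {y : InfWord X} {v} → PeriodicFrom b L y → 0 < L → IsQuasiperiodicWith y v →
                      ∃[ v′ ] (IsQuasiperiodicWith y v′ × length v′ < 2 * L)
  short-quasiperiod {b} {L} {y} {v} per 0<L qp = go v (<-wellFounded (length v)) qp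
    where
    go : ∀ v → Acc _<_ (length v) → IsQuasiperiodicWith y v →
         ∃[ v′ ] (IsQuasiperiodicWith y v′ × length v′ < 2 * L)
    go v (acc rec) qp with length v <? 2 * L
    ... | yes short = v , qp , short
    ... | no  long  with proj₂ qp (b + length v)
    ...   | i , _ , b+ℓ<i+ℓ , o =
      go (drop L v) (rec (subst (_< length v) (sym (length-drop L v)) (∸-monoʳ-< 0<L L≤ℓ)))
         (quasiperiodic-drop-period L (periodic-occurrence⇒period v per b≤i o) (≮⇒≥ long) qp)
      where
      b≤i : b ≤ i
      b≤i = <⇒≤ (+-cancelʳ-< (length v) b i b+ℓ<i+ℓ)
      L≤ℓ : L ≤ length v
      L≤ℓ = ≤-trans (m≤m+n L (L + 0)) (≮⇒≥ long)

  occurs-lookup : ∀ {y : InfWord X} {i} (v : List X) →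
                  (∀ t (t< : t < length v) → y (t + i) ≡ lookup v (fromℕ< t<)) → OccursAt y i v
  occurs-lookup []      _     = tt
  occurs-lookup {y} {i} (c ∷ v) agree =
    agree 0 z<s , occurs-lookup v (λ t t< → trans (cong y (+-suc t i)) (agree (suc t) (s≤s t<)))

  module _ (u : List X) .{{_ : NonZero (length u)}} where

    cycle : InfWord X
    cycle r = lookup u (r mod length u)

    cycle-cong : ∀ {r s} → r % length u ≡ s % length u → cycle r ≡ cycle s
    cycle-cong {r} {s} eq = cong (lookup u) (fromℕ<-cong _ _ eq (m%n<n r (length u)) (m%n<n s (length u)))

    cycle-periodic : PeriodicFrom 0 (length u) cycle
    cycle-periodic r _ = cycle-cong ([m+n]%n≡m%n r (length u))

    cycle-occurs-0 : OccursAt cycle 0 u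
    cycle-occurs-0 = occurs-lookup u (λ t t< → cong (lookup u)
      (fromℕ<-cong _ _ (trans (cong (_% length u) (+-identityʳ t)) (m<n⇒m%n≡m t<)) (m%n<n (t + 0) (length u)) t<))

    cycle-occurs-mod : ∀ j (v : List X) → OccursAt cycle j v → OccursAt cycle (j % length u) v
    cycle-occurs-mod j v = occurs-transport v (λ t _ → cycle-cong (begin
      (t + j) % L                   ≡⟨ %-distribˡ-+ t j L ⟩
      (t % L + j % L) % L           ≡⟨ cong (λ a → (t % L + a) % L) (sym (m%n%n≡m%n j L)) ⟩
      (t % L + j % L % L) % L       ≡⟨ sym (%-distribˡ-+ t (j % L) L) ⟩
      (t + j % L) % L               ∎))
      where
      open ≡-Reasoning
      L = length u

    cycle-occurs-cube : OccursAt cycle 0 (cube u)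
    cycle-occurs-cube =
      occurs-++ u (u ++ u) cycle-occurs-0 (occurs-++ u u once (periodic-occurs-shift u cycle-periodic z≤n once))
      where
      once : OccursAt cycle (length u + 0) u
      once = periodic-occurs-shift u cycle-periodic z≤n cycle-occurs-0

    cycle-factor-cube : ∀ j (v : List X) → OccursAt cycle j v → length v ≤ 2 * length u → Factor v (cube u)
    cycle-factor-cube j v o v≤2L =
      occurs-factor v (cube u) (j % L) cycle-occurs-cube (cycle-occurs-mod j v o) (begin
        j % L + length v           ≤⟨ +-mono-≤ (<⇒≤ (m%n<n j L)) v≤2L ⟩
        L + (L + (L + 0))          ≡⟨ cong (λ a → L + (L + a)) (+-identityʳ L) ⟩
        L + (L + L)                ≡⟨ cong (L +_) (sym (length-++ u)) ⟩
        L + length (u ++ u)        ≡⟨ sym (length-++ u) ⟩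
        length (cube u)            ∎)
      where
      open ≤-Reasoning
      L = length u

  splice : ℕ → InfWord X → InfWord X → InfWord X
  splice k y z r with r <? k
  ... | yes _ = y r
  ... | no  _ = z (r ∸ k)

  splice-< : ∀ {k r} (y z : InfWord X) → r < k → splice k y z r ≡ y r
  splice-< {k} {r} y z r<k with r <? k
  ... | yes _   = refl
  ... | no  r≮k = contradiction r<k r≮k

  splice-+ : ∀ k t (y z : InfWord X) → splice k y z (t + k) ≡ z t
  splice-+ k t y z with t + k <? k
  ... | yes t+k<k = contradiction t+k<k (≤⇒≯ (m≤n+m k t))
  ... | no  _     = cong z (m+n∸n≡m t k)

  occurs-splice-+ : ∀ {k t} {y z : InfWord X} (v : List X) → OccursAt (splice k y z) (t + k) v → OccursAt z t v
  occurs-splice-+ {k} {t} {y} {z} v =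
    occurs-transport v (λ s _ → trans (cong (splice k y z) (sym (+-assoc s t k))) (splice-+ k (s + t) y z))

module _ {A B : Set} (f : Morphism A B) where

  blockStart-mono : ∀ (w : InfWord A) {a b} → a ≤ b → blockStart f w a ≤ blockStart f w b
  blockStart-mono w {a} {b} a≤b = subst (λ c → blockStart f w a ≤ blockStart f w c) (m∸n+n≡m a≤b) (go (b ∸ a))
    where
    go : ∀ t → blockStart f w a ≤ blockStart f w (t + a)
    go zero    = ≤-refl
    go (suc t) = m≤n⇒m≤n+o (length (f (w (t + a)))) (go t)

  blockStart-≥ : NonErasing f → ∀ (w : InfWord A) k → k ≤ blockStart f w k
  blockStart-≥ ne w zero    = z≤n
  blockStart-≥ ne w (suc k) =
    subst (_≤ blockStart f w (suc k)) (+-comm k 1) (+-mono-≤ (blockStart-≥ ne w k) (ne (w k)))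

  blockStart-splice-≤ : ∀ {k k'} (w w' : InfWord A) → k' ≤ k →
                        blockStart f (splice k w w') k' ≡ blockStart f w k'
  blockStart-splice-≤ {k' = zero}   w w' _  = refl
  blockStart-splice-≤ {k' = suc k'} w w' k'<k =
    cong₂ _+_ (blockStart-splice-≤ w w' (<⇒≤ k'<k)) (cong (length ∘ f) (splice-< w w' k'<k))

  blockStart-splice-+ : ∀ k t (w w' : InfWord A) →
                        blockStart f (splice k w w') (t + k) ≡ blockStart f w' t + blockStart f w k
  blockStart-splice-+ k zero    w w' = blockStart-splice-≤ {k} w w' ≤-refl
  blockStart-splice-+ k (suc t) w w' = begin
    blockStart f (splice k w w') (t + k) + length (f (splice k w w' (t + k)))
      ≡⟨ cong₂ _+_ (blockStart-splice-+ k t w w') (cong (length ∘ f) (splice-+ k t w w')) ⟩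
    blockStart f w' t + blockStart f w k + length (f (w' t))
      ≡⟨ +-assoc (blockStart f w' t) _ _ ⟩
    blockStart f w' t + (blockStart f w k + length (f (w' t)))
      ≡⟨ cong (blockStart f w' t +_) (+-comm (blockStart f w k) _) ⟩
    blockStart f w' t + (length (f (w' t)) + blockStart f w k)
      ≡⟨ sym (+-assoc (blockStart f w' t) _ _) ⟩
    blockStart f w' (suc t) + blockStart f w k
      ∎
    where open ≡-Reasoning

  image-splice : ∀ {w w' : InfWord A} {x x' : InfWord B} → IsImage f w x → IsImage f w' x' →
                 ∀ k → IsImage f (splice k w w') (splice (blockStart f w k) x x')
  image-splice {w} {w'} {x} {x'} hx hx' k k' with <-≤-connex k' k
  ... | inj₁ k'<k =
    subst₂ (λ p a → OccursAt (splice b x x') p (f a))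
      (sym (blockStart-splice-≤ w w' (<⇒≤ k'<k))) (sym (splice-< w w' k'<k))
      (occurs-agreeBelow (f (w k')) (λ r r< → sym (splice-< x x' r<)) (blockStart-mono w k'<k) (hx k'))
    where b = blockStart f w k
  ... | inj₂ k≤k' = subst (λ k' → OccursAt (splice b x x') (blockStart f (splice k w w') k') (f (splice k w w' k')))
                          (m∸n+n≡m k≤k') (beyond (k' ∸ k))
    where
    b = blockStart f w k
    beyond : ∀ t → OccursAt (splice b x x') (blockStart f (splice k w w') (t + k)) (f (splice k w w' (t + k)))
    beyond t rewrite blockStart-splice-+ k t w w' | splice-+ k t w w' =
      occurs-transport (f (w' t))
        (λ s _ → sym (trans (cong (splice b x x') (sym (+-assoc s _ b))) (splice-+ b _ x x'))) (hx' t)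

  image-cycle : ∀ α .{{_ : NonZero (length (f α))}} → IsImage f (λ _ → α) (cycle (f α))
  image-cycle α zero    = cycle-occurs-0 (f α)
  image-cycle α (suc k) = subst (λ p → OccursAt (cycle (f α)) p (f α)) (+-comm (length (f α)) _)
    (periodic-occurs-shift (f α) (cycle-periodic (f α)) z≤n (image-cycle α k))

¬∀⇒¬¬∃¬ : {C : ℕ → Set} → (∀ p → Dec (C p)) → ¬ (∀ p → C p) → ¬ ¬ (∃[ p ] ¬ C p)
¬∀⇒¬¬∃¬ C? ¬all ¬ex = ¬all (λ p → decidable-stable (C? p) (λ ¬Cp → ¬ex (p , ¬Cp)))

¬¬-∀< : {Q : ℕ → Set} → ∀ M → (∀ l → l < M → ¬ ¬ Q l) → ¬ ¬ (∀ l → l < M → Q l)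
¬¬-∀< zero    _  ¬all = ¬all (λ _ ())
¬¬-∀< {Q} (suc M) ¬¬Q ¬all =
  ¬¬-∀< M (λ l l< → ¬¬Q l (m<n⇒m<1+n l<)) (λ below → ¬¬Q M ≤-refl (λ QM → ¬all (extend below QM)))
  where
  extend : (∀ l → l < M → Q l) → Q M → ∀ l → l < suc M → Q l
  extend below QM l l< with m<1+n⇒m<n∨m≡n l<
  ... | inj₁ l<M  = below l l<M
  ... | inj₂ refl = QM

common-bound : {R : ℕ → ℕ → Set} → ∀ M → (∀ l → l < M → ∃[ p ] R l p) →
               ∃[ N ] (∀ l → l < M → ∃[ p ] (p < N × R l p))
common-bound zero    _ = 0 , λ _ ()
common-bound {R} (suc M) witness with common-bound M (λ l l< → witness l (m<n⇒m<1+n l<)) | witness M ≤-refl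
... | N , below | p , Rp = N + suc p , bounded
  where
  bounded : ∀ l → l < suc M → ∃[ p′ ] (p′ < N + suc p × R l p′)
  bounded l l< with m<1+n⇒m<n∨m≡n l<
  ... | inj₁ l<M with below l l<M
  ...   | p′ , p′<N , Rp′ = p′ , <-≤-trans p′<N (m≤m+n N (suc p)) , Rp′
  bounded l l< | inj₂ refl = p , m≤n+m (suc p) N , Rp

module _ {A B : Set} (_≟_ : DecidableEquality B) {f : Morphism A B} (ne : NonErasing f)
         (sq : StronglyQuasiperiodic f) {w : InfWord A} {x : InfWord B} (hx : IsImage f w x)
         {q : List B} (hq : IsQuasiperiodOf x q) (α : A) where

  private
    u = f α
    L = length u
    instance
      L≢0 : NonZero L
      L≢0 = >-nonZero (ne α)

  OccursShortInCycle : Set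
  OccursShortInCycle = length q < 2 * L × ∃[ j ] (j < L × OccursAt (cycle u) j q)

  occursShortInCycle? : Dec OccursShortInCycle
  occursShortInCycle? = (length q <? 2 * L) ×-dec anyUpTo? (λ j → occurs? _≟_ (cycle u) j q) L

  -- x_k = f (w₀ ⋯ w_{k-1} α α α ⋯)
  spliced : ℕ → InfWord B
  spliced k = splice (blockStart f w k) x (cycle u)

  spliced-periodic : ∀ k → PeriodicFrom (blockStart f w k) L (spliced k)
  spliced-periodic k r b≤r = subst (λ r → spliced k (r + L) ≡ spliced k r) (m∸n+n≡m b≤r) (tail (r ∸ b))
    where
    open ≡-Reasoning
    b = blockStart f w k
    tail : ∀ t → spliced k (t + b + L) ≡ spliced k (t + b)
    tail t = begin
      spliced k (t + b + L)  ≡⟨ cong (spliced k) (trans (+-assoc t b L)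
                                  (trans (cong (t +_) (+-comm b L)) (sym (+-assoc t L b)))) ⟩
      spliced k (t + L + b)  ≡⟨ splice-+ b (t + L) x (cycle u) ⟩
      cycle u (t + L)        ≡⟨ cycle-periodic u t z≤n ⟩
      cycle u t              ≡⟨ sym (splice-+ b t x (cycle u)) ⟩
      spliced k (t + b)      ∎

  short-quasiperiod-of-spliced : ∀ k → ∃[ v ] (IsQuasiperiodicWith (spliced k) v × length v < 2 * L)
  short-quasiperiod-of-spliced k =
    short-quasiperiod (spliced-periodic k) (ne α) (proj₂ (sq _ _ (image-splice f hx (image-cycle f α) k)))

  longer-spliced-quasiperiod⇒occursShortInCycle :
    ∀ k {v} → 2 * L ≤ blockStart f w k → IsQuasiperiodicWith (spliced k) v → length v < 2 * L →
    length q ≤ length v → OccursShortInCycle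
  longer-spliced-quasiperiod⇒occursShortInCycle k {v} 2L≤b qp v<2L q≤v =
    let t , q++t≡v            = occurs-prefix q v oq₀ (quasiperiod-at-0 qp) q≤v
        i , _ , b+2L<i+v , oi = proj₂ qp (b + 2 * L)
        b≤i                   = <⇒≤ (+-cancelʳ-< (2 * L) b i (<-≤-trans b+2L<i+v (+-monoʳ-≤ i (<⇒≤ v<2L))))
        oqi                   = occurs-++⁻ˡ q t (subst (OccursAt (spliced k) i) (sym q++t≡v) oi)
    in q<2L , (i ∸ b) % L , m%n<n (i ∸ b) L ,
       cycle-occurs-mod u (i ∸ b) q
         (occurs-splice-+ q (subst (λ p → OccursAt (spliced k) p q) (sym (m∸n+n≡m b≤i)) oqi))
    where
    b = blockStart f w k
    q<2L : length q < 2 * L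
    q<2L = ≤-<-trans q≤v v<2L
    oq₀ : OccursAt (spliced k) 0 q
    oq₀ = occurs-agreeBelow q (λ r r< → sym (splice-< x (cycle u) r<)) (≤-trans (<⇒≤ q<2L) 2L≤b)
            (quasiperiod-at-0 (proj₁ hq))

  shorter-spliced-quasiperiod-covers :
    ∀ k N {v} → N + 2 * L ≤ blockStart f w k → IsQuasiperiodicWith (spliced k) v → length v < 2 * L →
    ∀ p → p < N → Covers x (window x 0 (length v)) p
  shorter-spliced-quasiperiod-covers k N {v} N+2L≤b qp v<2L p p<N with proj₂ qp p
  ... | i , i≤p , p<i+v , oi =
    i , i≤p , subst (λ v → p < i + length v) v≡window p<i+v ,
    subst (OccursAt x i) v≡window (occurs-agreeBelow v below (i+v≤b (<⇒≤ (≤-<-trans i≤p p<N))) oi)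
    where
    below : ∀ r → r < blockStart f w k → spliced k r ≡ x r
    below r r< = splice-< x (cycle u) r<
    i+v≤b : ∀ {i} → i ≤ N → i + length v ≤ blockStart f w k
    i+v≤b i≤N = ≤-trans (+-mono-≤ i≤N (<⇒≤ v<2L)) N+2L≤b
    v≡window : v ≡ window x 0 (length v)
    v≡window = occurs⇒window v (occurs-agreeBelow v below (i+v≤b z≤n) (quasiperiod-at-0 qp))

  occursShortInCycle-or-covered :
    ∀ N → OccursShortInCycle ⊎ ∃[ l ] (l < length q × (∀ p → p < N → Covers x (window x 0 l) p))
  occursShortInCycle-or-covered N =
    let v , qp , v<2L = short-quasiperiod-of-spliced k
    in Sum.map (longer-spliced-quasiperiod⇒occursShortInCycle k 2L≤b qp v<2L)
               (λ v<q → length v , v<q , shorter-spliced-quasiperiod-covers k N N+2L≤b qp v<2L)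
               (≤-<-connex (length q) (length v))
    where
    k = N + 2 * L
    N+2L≤b : N + 2 * L ≤ blockStart f w k
    N+2L≤b = blockStart-≥ f ne w k
    2L≤b : 2 * L ≤ blockStart f w k
    2L≤b = ≤-trans (m≤n+m (2 * L) N) N+2L≤b

  -- Each prefix shorter than q fails to cover some position; finding a common bound for these
  -- positions needs Markov's principle, so it is only obtained under ¬¬.
  ¬¬-uncovered-below : ¬ ¬ (∃[ N ] (∀ l → l < length q → ∃[ p ] (p < N × ¬ Covers x (window x 0 l) p)))
  ¬¬-uncovered-below = ¬¬-map (common-bound (length q)) (¬¬-∀< (length q) λ l l< →
    ¬∀⇒¬¬∃¬ (covers? _≟_ x (window x 0 l))
            (shorter-than-quasiperiod-¬covers hq (subst (_< length q) (sym (length-window x 0 l)) l<)))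

  occursShortInCycle : OccursShortInCycle
  occursShortInCycle = decidable-stable occursShortInCycle? λ ¬short → ¬¬-uncovered-below λ (N , uncovered) →
    case occursShortInCycle-or-covered N of λ where
      (inj₁ short)              → ¬short short
      (inj₂ (l , l<q , covered)) → let p , p<N , ¬covered = uncovered l l<q in ¬covered (covered p p<N)

  quasiperiod-factor-of-cube : Factor q (cube u) × length q < 2 * L
  quasiperiod-factor-of-cube =
    let q<2L , j , _ , occ = occursShortInCycle
    in cycle-factor-cube u j q occ (<⇒≤ q<2L) , q<2L

lemma5p1 : {m n : ℕ} (f : Morphism (Fin m) (Fin n)) →
           NonErasing f → StronglyQuasiperiodic f →
           ∀ (w : InfWord (Fin m)) (x : InfWord (Fin n)) → IsImage f w x →
           ∀ (q : List (Fin n)) → IsQuasiperiodOf x q →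
           (∀ (α : Fin m) → Factor q (cube (f α)) × length q < 2 * length (f α)) × InQ f q
lemma5p1 f ne sq w x hx q hq =
  factor∧short , proj₁ (proj₁ hq) , λ α → <⇒≤ (proj₂ (factor∧short α)) , proj₁ (factor∧short α)
  where
  factor∧short : ∀ α → Factor q (cube (f α)) × length q < 2 * length (f α)
  factor∧short = quasiperiod-factor-of-cube Fin._≟_ ne sq hx hq
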